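{- Let $t\geq 3$, let $\ell\in[3,t]$ be an odd integer, and let $\boldsymbol{R}$ be the symmetric $2t$-cycle in $\boldsymbol{H}(t,2)$ given by $R^0=\mathrm{T}^{(+)}$, $R^s={}_{ -[s]}R^0$ for $1\leq s\leq t-1$, and $R^{k+t}=-R^k$ for $0\leq k\leq t-1$. Consider the set of vertices $\mathcal{S}_\ell=\{T\in\{1,-1\}^t\colon |\boldsymbol{Q}(T,\boldsymbol{R})|=\ell\}$. Say that $T^-$ is a disjoint union of $m$ separated intervals if $T^-=[i_1,j_1]\,\dot\cup\cdots\dot\cup\,[i_m,j_m]$ with $i_k\leq j_k$ and $j_1+2\leq i_2,\ j_2+2\leq i_3,\ \ldots,\ j_{m-1}+2\leq i_m$. \begin{itemize} \item[(i)] (a) In $\mathcal{S}_\ell$ there are $\binom{t-1}{\ell}$ topes $T$ whose negative parts $T^-$ are disjoint unions of $\tfrac{\ell+1}{2}$ separated intervals $[i_1,j_1],\ldots,[i_{(\ell+1)/2},j_{(\ell+1)/2}]$ with $\{1,t\}\cap T^-=\{i_1\}=\{1\}$. More precisely, if $\tfrac{\ell+1}{2}\leq j\leq t-\tfrac{\ell+1}{2}$, then in $\mathcal{S}_\ell$ there are $\mathtt{c}(\tfrac{\ell+1}{2};j)\cdot\mathtt{c}(\tfrac{\ell+1}{2};t-j)=\binom{j-1}{(\ell-1)/2}\binom{t-j-1}{(\ell-1)/2}$ topes $T$ with $|T^-|=j$ whose negative parts are such disjoint unions of $\tfrac{\ell+1}{2}$ separated intervals with $\{1,t\}\cap T^-=\{i_1\}=\{1\}$.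 (b) In $\mathcal{S}_\ell$ there are $\binom{t-1}{\ell}$ topes $T$ whose negative parts $T^-$ are disjoint unions of $\tfrac{\ell+1}{2}$ separated intervals with $\{1,t\}\cap T^-=\{j_{(\ell+1)/2}\}=\{t\}$. More precisely, if $\tfrac{\ell+1}{2}\leq j\leq t-\tfrac{\ell+1}{2}$, then in $\mathcal{S}_\ell$ there are $\binom{j-1}{(\ell-1)/2}\binom{t-j-1}{(\ell-1)/2}$ topes $T$ with $|T^-|=j$ whose negative parts are such disjoint unions of $\tfrac{\ell+1}{2}$ separated intervals with $\{1,t\}\cap T^-=\{j_{(\ell+1)/2}\}=\{t\}$. \item[(ii)] In $\mathcal{S}_\ell$ there are $\binom{t-1}{\ell-1}$ topes $T$ whose negative parts $T^-$ are disjoint unions of $\tfrac{\ell+1}{2}$ separated intervals with $\{1,t\}\cap T^-=\{i_1,j_{(\ell+1)/2}\}=\{1,t\}$. More precisely, if $\tfrac{\ell+1}{2}\leq j\leq t-\tfrac{\ell-1}{2}$, then in $\mathcal{S}_\ell$ there are $\mathtt{c}(\tfrac{\ell+1}{2};j)\cdot\mathtt{c}(\tfrac{\ell-1}{2};t-j)=\binom{j-1}{(\ell-1)/2}\binom{t-j-1}{(\ell-3)/2}$ topes $T$ with $|T^-|=j$ whose negative parts are such disjoint unions with $\{1,t\}\cap T^-=\{1,t\}$. \item[(iii)] In $\mathcal{S}_\ell$ there are $\binom{t-1}{\ell-1}$ topes $T$ whose negative parts $T^-$ are disjoint unions of $\tfrac{\ell-1}{2}$ separated intervals with $\{1,t\}\cap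 T^-=\emptyset$. More precisely, if $\tfrac{\ell-1}{2}\leq j\leq t-\tfrac{\ell+1}{2}$, then in $\mathcal{S}_\ell$ there are $\mathtt{c}(\tfrac{\ell-1}{2};j)\cdot\mathtt{c}(\tfrac{\ell+1}{2};t-j)=\binom{j-1}{(\ell-3)/2}\binom{t-j-1}{(\ell-1)/2}$ topes $T$ with $|T^-|=j$ whose negative parts are disjoint unions of $\tfrac{\ell-1}{2}$ separated intervals with $\{1,t\}\cap T^-=\emptyset$. \end{itemize}
   Context: Let $t\geq 3$ be an integer and $E_t=[t]=\{1,\ldots,t\}$; for integers $a\leq b$, $[a,b]=\{a,\ldots,b\}$. The hypercube graph $\boldsymbol{H}(t,2)$ has vertex set $\{1,-1\}^t$ (topes), row vectors $T=(T(1),\ldots,T(t))$; vertices are adjacent iff they differ in exactly one coordinate. $\mathrm{T}^{(+)}=(1,\ldots,1)$. For $A\subseteq E_t$, ${}_{ -A}T$ is obtained from $T$ by negating the coordinates indexed by $A$. The negative part of $T$ is $T^-=\{e\in E_t\colon T(e)=-1\}$. Let $\mathbf{M}$ be the (nonsingular) $t\times t$ matrix with rows $R^0,\ldots,R^{t-1}$, and for a tope $T$ let $\boldsymbol{x}(T,\boldsymbol{R})=T\mathbf{M}^{ -1}\in\{ -1,0,1\}^t$. $\boldsymbol{Q}(T,\boldsymbol{R})$ is the unique inclusion-minimal subset of the vertex set of $\boldsymbol{R}$ whose sum is $T$ (known to exist and be unique); equivalently $\boldsymbol{Q}(T,\boldsymbol{R})=\{x_i R^{i-1}\colon x_i\neq0\}$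 where $(x_1,\ldots,x_t)=\boldsymbol{x}(T,\boldsymbol{R})$, so $|\boldsymbol{Q}(T,\boldsymbol{R})|$ is the number of nonzero entries of $\boldsymbol{x}(T,\boldsymbol{R})$. $\mathtt{c}(m;n)$ denotes the number of compositions of a positive integer $n$ into $m$ positive parts, i.e. $\binom{n-1}{m-1}$. -}

module Defs where

open import Data.Nat using (ℕ; zero; suc; _+_; _∸_; _≤_; _<_; _<ᵇ_)
open import Data.Bool using (Bool; true; false; if_then_else_)
open import Data.Integer as ℤ using (ℤ; +_; -[1+_]; 0ℤ; 1ℤ; -1ℤ)
open import Data.Fin using (Fin; toℕ)
open import Data.Vec using (Vec; []; _∷_; lookup)
open import Data.List using (List; []; _∷_; length)
open import Data.List.Relation.Unary.Any using (Any)
open import Data.List.Relation.Unary.Unique.Propositional using (Unique)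
open import Data.List.Membership.Propositional using (_∈_)
open import Data.Product using (_×_; _,_; ∃-syntax; proj₁; proj₂)
open import Data.Unit using (⊤)
open import Data.Empty using (⊥)
open import Relation.Binary.PropositionalEquality using (_≡_)
open import Function.Bundles using (_⇔_)

-- Signs and topes of the hypercube H(t,2).
-- A tope T ∈ {1,-1}^t is a Vec Sign t; coordinate e ∈ [t] = {1,…,t}
-- is stored at position (e - 1) : Fin t.

data Sign : Set where
  plus minus : Sign

signℤ : Sign → ℤ
signℤ plus  = 1ℤ
signℤ minus = -1ℤ

Tope : ℕ → Set
Tope t = Vec Sign t

-- The symmetric 2t-cycle R:  R^0 = T^(+),  R^s = _{-[s]} R^0 (1 ≤ s ≤ t-1),
-- R^{k+t} = - R^k.  R k e is the entry R^k(e+1) (e : Fin t, 0-based).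

R : (t : ℕ) → ℕ → Fin t → ℤ
R t k e =
  if k <ᵇ t
  then (if toℕ e <ᵇ k then -1ℤ else 1ℤ)
  else ℤ.- (if toℕ e <ᵇ (k ∸ t) then -1ℤ else 1ℤ)

Σ : ∀ {n} → (Fin n → ℤ) → ℤ
Σ {zero}  f = 0ℤ
Σ {suc n} f = f Fin.zero ℤ.+ Σ (λ i → f (Fin.suc i))

-- x is the coordinate row vector x(T,R) = T M^{-1}, where M is the t×t
-- matrix with rows R^0,…,R^{t-1}; i.e. x M = T.  (M is nonsingular,
-- so x is unique.)
IsXTR : (t : ℕ) → Tope t → Vec ℤ t → Set
IsXTR t T x = ∀ (e : Fin t) →
  Σ (λ (s : Fin t) → lookup x s ℤ.* R t (toℕ s) e) ≡ signℤ (lookup T e)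

nnz : ∀ {n} → Vec ℤ n → ℕ
nnz []                 = 0
nnz (+ zero    ∷ xs)   = nnz xs
nnz (+ suc _   ∷ xs)   = suc (nnz xs)
nnz (-[1+ _ ]  ∷ xs)   = suc (nnz xs)

-- |Q(T,R)| = ℓ  (number of nonzero entries of x(T,R)), i.e. T ∈ S_ℓ.
InS : (t ℓ : ℕ) → Tope t → Set
InS t ℓ T = ∃[ x ] (IsXTR t T x × nnz x ≡ ℓ)

NegAt : ∀ {t} → Tope t → ℕ → Set
NegAt {t} T e = ∃[ f ] (suc (toℕ {t} f) ≡ e × lookup T f ≡ minus)

negCount : ∀ {t} → Tope t → ℕ
negCount []            = 0
negCount (plus  ∷ T)   = negCount T
negCount (minus ∷ T)   = suc (negCount T)

Separated : List (ℕ × ℕ) → Set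
Separated []                           = ⊤
Separated ((i , j) ∷ [])               = i ≤ j
Separated ((i , j) ∷ ((i' , j') ∷ L))  = i ≤ j × j + 2 ≤ i' × Separated ((i' , j') ∷ L)

InUnion : List (ℕ × ℕ) → ℕ → Set
InUnion L e = Any (λ p → proj₁ p ≤ e × e ≤ proj₂ p) L

SepDecomp : ∀ {t} → Tope t → ℕ → List (ℕ × ℕ) → Set
SepDecomp T m L = length L ≡ m × Separated L × (∀ e → NegAt T e ⇔ InUnion L e)

FirstLeft : List (ℕ × ℕ) → ℕ → Set
FirstLeft []            a = ⊥
FirstLeft ((i , _) ∷ _) a = i ≡ a

LastRight : List (ℕ × ℕ) → ℕ → Set
LastRight []                 b = ⊥
LastRight ((_ , j) ∷ [])     b = j ≡ b
LastRight (_ ∷ (p ∷ L))      b = LastRight (p ∷ L) b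

CountIs : (t : ℕ) → (Tope t → Set) → ℕ → Set
CountIs t P N = ∃[ L ] (Unique L × (∀ (T : Tope t) → T ∈ L ⇔ P T) × length L ≡ N)

FamA : (t m : ℕ) → Tope t → Set
FamA t m T = ∃[ L ] (SepDecomp T m L × FirstLeft L 1 × NegAt T 1 × (NegAt T t → ⊥))

FamB : (t m : ℕ) → Tope t → Set
FamB t m T = ∃[ L ] (SepDecomp T m L × LastRight L t × NegAt T t × (NegAt T 1 → ⊥))

FamC : (t m : ℕ) → Tope t → Set
FamC t m T = ∃[ L ] (SepDecomp T m L × FirstLeft L 1 × LastRight L t × NegAt T 1 × NegAt T t)

FamD : (t m : ℕ) → Tope t → Set
FamD t m T = ∃[ L ] (SepDecomp T m L × (NegAt T 1 → ⊥) × (NegAt T t → ⊥))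

-- For the symmetric 2t-cycle R, rows R^0, …, R^{t-1} of M are staircases, and the
-- system x M = T has the explicit unique solution x_1 = (T(1) + T(t))/2,
-- x_{s+1} = (T(s+1) - T(s))/2.  Hence |Q(T,R)| = [T(1) = T(t)] + (number of sign
-- changes of T), so membership in S_ℓ only depends on the end signs and the number of
-- sign changes.  On the other side the negative part of T decomposes canonically into
-- its maximal runs, which are separated intervals; their number is determined by the
-- first sign and the number of runs.  Each of the four families is therefore exactly
-- the set of topes with a prescribed first sign and a prescribed number of sign changes
-- (a "shape"), the last sign following by parity.

module Submission where

open import Defs
open import Data.Nat using (ℕ; suc; _+_; _*_; _∸_; _≤_)
open import Data.Nat.Combinatorics using (_C_)
open import Data.Product using (_×_)
open import Relation.Binary.PropositionalEquality using (_≡_)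

open import Data.Nat as ℕ using (zero; _<_; _<ᵇ_; _≟_; z≤n; s≤s)
import Data.Nat.Properties as ℕP
open import Data.Nat.Combinatorics using (nCk+nC[k+1]≡[n+1]C[k+1])
open import Data.Integer as ℤ using (ℤ; +_; 0ℤ; 1ℤ; -1ℤ)
import Data.Integer.Properties as ℤP
open import Data.Integer.Tactic.RingSolver using (solve-∀)
open import Data.Bool as Bool using (true; false; if_then_else_)
open import Data.Fin as F using (Fin; toℕ)
open import Data.Vec using (Vec; []; _∷_; lookup; head; tail)
import Data.Vec.Properties as VecP
open import Data.Product using (_,_; proj₁; proj₂; ∃-syntax)
open import Data.Sum using (_⊎_; inj₁; inj₂; [_,_]′)
open import Data.Empty using (⊥; ⊥-elim)
open import Data.Unit using (⊤; tt)
open import Data.List using (List; []; _∷_; length; map; _++_; filter)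
import Data.List.Properties as ListP
import Data.List.Relation.Unary.All as All
open import Data.List.Relation.Unary.Any using (here; there)
open import Data.List.Relation.Unary.AllPairs using ([]; _∷_)
open import Data.List.Membership.Propositional using (_∈_)
open import Data.List.Membership.Propositional.Properties
  using (∈-map⁺; ∈-map⁻; ∈-++⁺ˡ; ∈-++⁺ʳ; ∈-++⁻; ∈-filter⁺; ∈-filter⁻)
open import Data.List.Relation.Unary.Unique.Propositional using (Unique)
import Data.List.Relation.Unary.Unique.Propositional.Properties as UniqueP
open import Relation.Nullary using (¬_; does)
open import Relation.Unary using (Decidable)
open import Relation.Binary.PropositionalEquality
  using (refl; sym; trans; cong; cong₂; subst; module ≡-Reasoning)
open import Function.Bundles using (_⇔_; mk⇔; Equivalence)
open Equivalence using (to; from)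

flip : Sign → Sign
flip plus  = minus
flip minus = plus

alternate : ℕ → Sign → Sign
alternate zero    a = a
alternate (suc k) a = alternate k (flip a)

differ : Sign → Sign → ℕ
differ plus  plus  = 0
differ minus minus = 0
differ plus  minus = 1
differ minus plus  = 1

agree : Sign → Sign → ℕ
agree a b = 1 ∸ differ a b

lastFrom : ∀ {n} → Sign → Vec Sign n → Sign
lastFrom a []      = a
lastFrom a (b ∷ T) = lastFrom b T

changesFrom : ∀ {n} → Sign → Vec Sign n → ℕ
changesFrom a []      = 0
changesFrom a (b ∷ T) = differ a b + changesFrom b T

lastSign : ∀ {n} → Vec Sign (suc n) → Sign
lastSign (a ∷ T) = lastFrom a T

changes : ∀ {n} → Vec Sign (suc n) → ℕ
changes (a ∷ T) = changesFrom a T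

runs : ∀ {n} → Vec Sign n → ℕ
runs []      = 0
runs (a ∷ T) = suc (changesFrom a T)

-- minusRuns a k / plusRuns a k : how many of k alternating runs, the first of
-- sign a, are negative / positive
minusRuns : Sign → ℕ → ℕ
minusRuns a     zero    = 0
minusRuns minus (suc k) = suc (minusRuns plus k)
minusRuns plus  (suc k) = minusRuns minus k

plusRuns : Sign → ℕ → ℕ
plusRuns a k = minusRuns (flip a) k

plus≢minus : ¬ (plus ≡ minus)
plus≢minus ()

flip-≢ : ∀ a → ¬ (a ≡ flip a)
flip-≢ plus  ()
flip-≢ minus ()

flip-involutive : ∀ a → flip (flip a) ≡ a
flip-involutive plus  = refl
flip-involutive minus = refl

not-minus : ∀ {a} → ¬ (a ≡ minus) → a ≡ plus
not-minus {plus}  _   = refl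
not-minus {minus} a≢m = ⊥-elim (a≢m refl)

lastFrom-parity : ∀ {n} a (T : Vec Sign n) → lastFrom a T ≡ alternate (changesFrom a T) a
lastFrom-parity a     []          = refl
lastFrom-parity plus  (plus  ∷ T) = lastFrom-parity plus T
lastFrom-parity plus  (minus ∷ T) = lastFrom-parity minus T
lastFrom-parity minus (plus  ∷ T) = lastFrom-parity plus T
lastFrom-parity minus (minus ∷ T) = lastFrom-parity minus T

alternate-even : ∀ r a → alternate (2 * r) a ≡ a
alternate-even zero    a = refl
alternate-even (suc r) a = begin
  alternate (2 * suc r) a           ≡⟨ cong (λ k → alternate k a) (ℕP.*-suc 2 r) ⟩
  alternate (2 * r) (flip (flip a)) ≡⟨ cong (alternate (2 * r)) (flip-involutive a) ⟩
  alternate (2 * r) a               ≡⟨ alternate-even r a ⟩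
  a                                 ∎
  where open ≡-Reasoning

alternate-odd : ∀ r a → alternate (suc (2 * r)) a ≡ flip a
alternate-odd r a = alternate-even r (flip a)

minusRuns-2+ : ∀ a k → minusRuns a (2 + k) ≡ suc (minusRuns a k)
minusRuns-2+ plus  k = refl
minusRuns-2+ minus k = refl

minusRuns-even : ∀ a r → minusRuns a (2 * r) ≡ r
minusRuns-even a zero    = refl
minusRuns-even a (suc r) = begin
  minusRuns a (2 * suc r)   ≡⟨ cong (minusRuns a) (ℕP.*-suc 2 r) ⟩
  minusRuns a (2 + 2 * r)   ≡⟨ minusRuns-2+ a (2 * r) ⟩
  suc (minusRuns a (2 * r)) ≡⟨ cong suc (minusRuns-even a r) ⟩
  suc r                     ∎
  where open ≡-Reasoning

-- The coordinates x(T,R)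

stair : ℕ → ℕ → ℤ
stair k e = if e <ᵇ k then -1ℤ else 1ℤ

R-stair : ∀ {t} k (e : Fin t) → k < t → R t k e ≡ stair k (toℕ e)
R-stair {t} k e k<t with k <ᵇ t in eq
... | true  = refl
... | false = ⊥-elim (subst Bool.T eq (ℕP.<⇒<ᵇ k<t))

combination : ∀ {m} → Vec ℤ m → ℕ → ℕ → ℤ
combination []       k e = 0ℤ
combination (x ∷ xs) k e = x ℤ.* stair k e ℤ.+ combination xs (suc k) e

sumℤ : ∀ {m} → Vec ℤ m → ℤ
sumℤ []       = 0ℤ
sumℤ (x ∷ xs) = x ℤ.+ sumℤ xs

-- Row 0 is constantly 1.
combination-from-0 : ∀ {m} x (xs : Vec ℤ m) e →
  combination (x ∷ xs) 0 e ≡ x ℤ.+ combination xs 1 e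
combination-from-0 x xs e = cong (ℤ._+ combination xs 1 e) (ℤP.*-identityʳ x)

combination-shift : ∀ {m} (xs : Vec ℤ m) k e →
  combination xs (suc k) (suc e) ≡ combination xs k e
combination-shift []       k e = refl
combination-shift (x ∷ xs) k e =
  cong (λ w → x ℤ.* stair k e ℤ.+ w) (combination-shift xs (suc k) e)

-- In entry 0 every row but R^0 is -1.
combination-at-0 : ∀ {m} (xs : Vec ℤ m) k → combination xs (suc k) 0 ≡ ℤ.- sumℤ xs
combination-at-0 []       k = refl
combination-at-0 (x ∷ xs) k = begin
  x ℤ.* -1ℤ ℤ.+ combination xs (suc (suc k)) 0
    ≡⟨ cong (λ w → x ℤ.* -1ℤ ℤ.+ w) (combination-at-0 xs (suc k)) ⟩
  x ℤ.* -1ℤ ℤ.+ ℤ.- sumℤ xs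
    ≡⟨ negate-sum x (sumℤ xs) ⟩
  ℤ.- (x ℤ.+ sumℤ xs) ∎
  where
  open ≡-Reasoning
  negate-sum : ∀ x s → x ℤ.* -1ℤ ℤ.+ ℤ.- s ≡ ℤ.- (x ℤ.+ s)
  negate-sum = solve-∀

row-0 : ∀ {m} x (xs : Vec ℤ m) → combination (x ∷ xs) 0 0 ≡ x ℤ.- sumℤ xs
row-0 x xs = trans (combination-from-0 x xs 0) (cong (ℤ._+_ x) (combination-at-0 xs 0))

Σ-cong : ∀ {n} {f g : Fin n → ℤ} → (∀ i → f i ≡ g i) → Σ f ≡ Σ g
Σ-cong {zero}  eq = refl
Σ-cong {suc n} eq = cong₂ ℤ._+_ (eq F.zero) (Σ-cong (λ i → eq (F.suc i)))

Σ-rows : ∀ t (e : Fin t) m k (x : Vec ℤ m) → k + m ≤ t →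
  Σ (λ s → lookup x s ℤ.* R t (k + toℕ s) e) ≡ combination x k (toℕ e)
Σ-rows t e zero    k []       _     = refl
Σ-rows t e (suc m) k (x ∷ xs) k+m≤t = cong₂ ℤ._+_ first-term other-terms
  where
  first-term : x ℤ.* R t (k + 0) e ≡ x ℤ.* stair k (toℕ e)
  first-term = cong (x ℤ.*_) (trans (cong (λ i → R t i e) (ℕP.+-identityʳ k))
                 (R-stair k e (ℕP.<-≤-trans (ℕP.m<m+n k (s≤s z≤n)) k+m≤t)))
  other-terms : Σ (λ s → lookup xs s ℤ.* R t (k + suc (toℕ s)) e) ≡ combination xs (suc k) (toℕ e)
  other-terms = trans (Σ-cong (λ s → cong (λ i → lookup xs s ℤ.* R t i e) (ℕP.+-suc k (toℕ s))))
                      (Σ-rows t e m (suc k) xs (subst (_≤ t) (ℕP.+-suc k m) k+m≤t))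

Solves : ∀ {n} → Vec Sign (suc n) → Vec ℤ (suc n) → Set
Solves T x = ∀ e → combination x 0 (toℕ e) ≡ signℤ (lookup T e)

IsXTR⇔Solves : ∀ {n} (T : Vec Sign (suc n)) x → IsXTR (suc n) T x ⇔ Solves T x
IsXTR⇔Solves T x =
  mk⇔ (λ isX e → trans (sym (Σ-rows _ e _ 0 x ℕP.≤-refl)) (isX e))
      (λ solves e → trans (Σ-rows _ e _ 0 x ℕP.≤-refl) (solves e))

-- mean a b = (a + b)/2 and step a b = (b − a)/2, as integers
mean : Sign → Sign → ℤ
mean plus  plus  = 1ℤ
mean minus minus = -1ℤ
mean plus  minus = 0ℤ
mean minus plus  = 0ℤ

step : Sign → Sign → ℤ
step plus  plus  = 0ℤ
step minus minus = 0ℤ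
step plus  minus = -1ℤ
step minus plus  = 1ℤ

steps : ∀ {n} → Vec Sign (suc n) → Vec ℤ n
steps (a ∷ [])      = []
steps (a ∷ (b ∷ T)) = step a b ∷ steps (b ∷ T)

coordinates : ∀ {n} → Vec Sign (suc n) → Vec ℤ (suc n)
coordinates T = mean (head T) (lastSign T) ∷ steps T

step-refl : ∀ a → step a a ≡ 0ℤ
step-refl plus  = refl
step-refl minus = refl

step-telescope : ∀ a b c → step a b ℤ.+ step b c ≡ step a c
step-telescope plus  plus  c     = ℤP.+-identityˡ (step plus c)
step-telescope minus minus c     = ℤP.+-identityˡ (step minus c)
step-telescope plus  minus plus  = refl
step-telescope plus  minus minus = refl
step-telescope minus plus  plus  = refl
step-telescope minus plus  minus = refl

mean-step : ∀ a b c → mean a c ℤ.+ step a b ≡ mean b c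
mean-step plus  plus  plus  = refl
mean-step plus  plus  minus = refl
mean-step plus  minus plus  = refl
mean-step plus  minus minus = refl
mean-step minus plus  plus  = refl
mean-step minus plus  minus = refl
mean-step minus minus plus  = refl
mean-step minus minus minus = refl

mean-minus-step : ∀ a c → mean a c ℤ.- step a c ≡ signℤ a
mean-minus-step plus  plus  = refl
mean-minus-step plus  minus = refl
mean-minus-step minus plus  = refl
mean-minus-step minus minus = refl

mean-refl : ∀ a → mean a a ≡ signℤ a
mean-refl plus  = refl
mean-refl minus = refl

double-step : ∀ a b c → mean b c ℤ.- signℤ a ℤ.- step b c ≡ step a b ℤ.+ step a b
double-step plus  plus  plus  = refl
double-step plus  plus  minus = refl
double-step plus  minus plus  = refl
double-step plus  minus minus = refl
double-step minus plus  plus  = refl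
double-step minus plus  minus = refl
double-step minus minus plus  = refl
double-step minus minus minus = refl

sum-steps : ∀ {n} (T : Vec Sign (suc n)) → sumℤ (steps T) ≡ step (head T) (lastSign T)
sum-steps (a ∷ [])      = sym (step-refl a)
sum-steps (a ∷ (b ∷ T)) =
  trans (cong (ℤ._+_ (step a b)) (sum-steps (b ∷ T))) (step-telescope a b (lastFrom b T))

-- The coordinates solve the system: entry 0 by telescoping the steps, entry e+1 by
-- induction, since x_1 + step(T(1),T(2)) is the first coordinate for the tail.
coordinates-solve : ∀ {n} (T : Vec Sign (suc n)) → Solves T (coordinates T)
coordinates-solve (a ∷ T) F.zero = begin
  combination (mean a l ∷ steps (a ∷ T)) 0 0 ≡⟨ row-0 (mean a l) (steps (a ∷ T)) ⟩
  mean a l ℤ.- sumℤ (steps (a ∷ T))          ≡⟨ cong (ℤ._-_ (mean a l)) (sum-steps (a ∷ T)) ⟩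
  mean a l ℤ.- step a l                      ≡⟨ mean-minus-step a l ⟩
  signℤ a                                    ∎
  where
  open ≡-Reasoning
  l = lastFrom a T
coordinates-solve (a ∷ (b ∷ T)) (F.suc e) = begin
  combination (mean a l ∷ step a b ∷ rest) 0 (suc i)
    ≡⟨ combination-from-0 (mean a l) (step a b ∷ rest) (suc i) ⟩
  mean a l ℤ.+ combination (step a b ∷ rest) 1 (suc i)
    ≡⟨ cong (ℤ._+_ (mean a l)) (combination-shift (step a b ∷ rest) 0 i) ⟩
  mean a l ℤ.+ combination (step a b ∷ rest) 0 i
    ≡⟨ cong (ℤ._+_ (mean a l)) (combination-from-0 (step a b) rest i) ⟩
  mean a l ℤ.+ (step a b ℤ.+ combination rest 1 i)
    ≡⟨ sym (ℤP.+-assoc (mean a l) (step a b) _) ⟩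
  (mean a l ℤ.+ step a b) ℤ.+ combination rest 1 i
    ≡⟨ cong (ℤ._+ combination rest 1 i) (mean-step a b l) ⟩
  mean b l ℤ.+ combination rest 1 i
    ≡⟨ sym (combination-from-0 (mean b l) rest i) ⟩
  combination (mean b l ∷ rest) 0 i
    ≡⟨ coordinates-solve (b ∷ T) e ⟩
  signℤ (lookup (b ∷ T) e) ∎
  where
  open ≡-Reasoning
  i    = toℕ e
  l    = lastFrom b T
  rest = steps (b ∷ T)

merge-solution : ∀ {n} a (T : Vec Sign (suc n)) x₀ x₁ xs →
  Solves (a ∷ T) (x₀ ∷ x₁ ∷ xs) → Solves T ((x₀ ℤ.+ x₁) ∷ xs)
merge-solution a T x₀ x₁ xs solves e = begin
  combination ((x₀ ℤ.+ x₁) ∷ xs) 0 i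
    ≡⟨ combination-from-0 (x₀ ℤ.+ x₁) xs i ⟩
  (x₀ ℤ.+ x₁) ℤ.+ combination xs 1 i
    ≡⟨ ℤP.+-assoc x₀ x₁ _ ⟩
  x₀ ℤ.+ (x₁ ℤ.+ combination xs 1 i)
    ≡⟨ cong (ℤ._+_ x₀) (sym (combination-from-0 x₁ xs i)) ⟩
  x₀ ℤ.+ combination (x₁ ∷ xs) 0 i
    ≡⟨ cong (ℤ._+_ x₀) (sym (combination-shift (x₁ ∷ xs) 0 i)) ⟩
  x₀ ℤ.+ combination (x₁ ∷ xs) 1 (suc i)
    ≡⟨ sym (combination-from-0 x₀ (x₁ ∷ xs) (suc i)) ⟩
  combination (x₀ ∷ x₁ ∷ xs) 0 (suc i)
    ≡⟨ solves (F.suc e) ⟩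
  signℤ (lookup T e) ∎
  where
  open ≡-Reasoning
  i = toℕ e

halve : ∀ (x y : ℤ) → x ℤ.+ x ≡ y ℤ.+ y → x ≡ y
halve x y eq = ℤP.*-cancelˡ-≡ (+ 2) x y (trans (twice x) (trans eq (sym (twice y))))
  where
  twice : ∀ z → + 2 ℤ.* z ≡ z ℤ.+ z
  twice = solve-∀

-- Uniqueness, by induction: the merged solution for b ∷ T is the coordinate vector
-- of b ∷ T, which fixes x₀ + x₁ and xs; row 0 then fixes x₀ − x₁.
coordinates-unique : ∀ {n} (T : Vec Sign (suc n)) x → Solves T x → x ≡ coordinates T
coordinates-unique (a ∷ []) (x₀ ∷ []) solves = cong (_∷ []) (begin
  x₀                        ≡⟨ sym (ℤP.+-identityʳ x₀) ⟩
  x₀ ℤ.- sumℤ []            ≡⟨ sym (row-0 x₀ []) ⟩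
  combination (x₀ ∷ []) 0 0 ≡⟨ solves F.zero ⟩
  signℤ a                   ≡⟨ sym (mean-refl a) ⟩
  mean a a                  ∎)
  where open ≡-Reasoning
coordinates-unique (a ∷ (b ∷ T)) (x₀ ∷ (x₁ ∷ xs)) solves = cong₂ _∷_ x₀-eq (cong₂ _∷_ x₁-eq xs-eq)
  where
  open ≡-Reasoning
  l = lastFrom b T
  merged-eq : (x₀ ℤ.+ x₁) ∷ xs ≡ coordinates (b ∷ T)
  merged-eq = coordinates-unique (b ∷ T) _ (merge-solution a (b ∷ T) x₀ x₁ xs solves)
  sum-eq : x₀ ℤ.+ x₁ ≡ mean b l
  sum-eq = cong head merged-eq
  xs-eq : xs ≡ steps (b ∷ T)
  xs-eq = cong tail merged-eq
  sum-xs : sumℤ xs ≡ step b l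
  sum-xs = trans (cong sumℤ xs-eq) (sum-steps (b ∷ T))
  row-0-eq : x₀ ℤ.- (x₁ ℤ.+ step b l) ≡ signℤ a
  row-0-eq = begin
    x₀ ℤ.- (x₁ ℤ.+ step b l)       ≡⟨ cong (λ s → x₀ ℤ.- (x₁ ℤ.+ s)) (sym sum-xs) ⟩
    x₀ ℤ.- sumℤ (x₁ ∷ xs)          ≡⟨ sym (row-0 x₀ (x₁ ∷ xs)) ⟩
    combination (x₀ ∷ x₁ ∷ xs) 0 0 ≡⟨ solves F.zero ⟩
    signℤ a                        ∎
  x₁-eq : x₁ ≡ step a b
  x₁-eq = halve x₁ (step a b) (begin
    x₁ ℤ.+ x₁
      ≡⟨ eliminate-x₀ x₀ x₁ (step b l) ⟩
    (x₀ ℤ.+ x₁) ℤ.- (x₀ ℤ.- (x₁ ℤ.+ step b l)) ℤ.- step b l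
      ≡⟨ cong₂ (λ u v → u ℤ.- v ℤ.- step b l) sum-eq row-0-eq ⟩
    mean b l ℤ.- signℤ a ℤ.- step b l
      ≡⟨ double-step a b l ⟩
    step a b ℤ.+ step a b ∎)
    where
    eliminate-x₀ : ∀ x y s → y ℤ.+ y ≡ (x ℤ.+ y) ℤ.- (x ℤ.- (y ℤ.+ s)) ℤ.- s
    eliminate-x₀ = solve-∀
  x₀-eq : x₀ ≡ mean a l
  x₀-eq = begin
    x₀                                     ≡⟨ cancel x₀ x₁ ⟩
    (x₀ ℤ.+ x₁) ℤ.- x₁                     ≡⟨ cong₂ ℤ._-_ sum-eq x₁-eq ⟩
    mean b l ℤ.- step a b                  ≡⟨ cong (ℤ._- step a b) (sym (mean-step a b l)) ⟩
    (mean a l ℤ.+ step a b) ℤ.- step a b   ≡⟨ sym (cancel (mean a l) (step a b)) ⟩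
    mean a l                               ∎
    where
    cancel : ∀ x y → x ≡ (x ℤ.+ y) ℤ.- y
    cancel = solve-∀

nnz-steps : ∀ {n} (T : Vec Sign (suc n)) → nnz (steps T) ≡ changes T
nnz-steps (a ∷ [])              = refl
nnz-steps (plus  ∷ (plus  ∷ T)) = nnz-steps (plus ∷ T)
nnz-steps (plus  ∷ (minus ∷ T)) = cong suc (nnz-steps (minus ∷ T))
nnz-steps (minus ∷ (plus  ∷ T)) = cong suc (nnz-steps (plus ∷ T))
nnz-steps (minus ∷ (minus ∷ T)) = nnz-steps (minus ∷ T)

nnz-mean : ∀ {n} a b (v : Vec ℤ n) → nnz (mean a b ∷ v) ≡ agree a b + nnz v
nnz-mean plus  plus  v = refl
nnz-mean plus  minus v = refl
nnz-mean minus plus  v = refl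
nnz-mean minus minus v = refl

nnz-coordinates : ∀ {n} (T : Vec Sign (suc n)) →
  nnz (coordinates T) ≡ agree (head T) (lastSign T) + changes T
nnz-coordinates T = trans (nnz-mean (head T) (lastSign T) (steps T))
                          (cong (_+_ (agree (head T) (lastSign T))) (nnz-steps T))

InS⇔ : ∀ {n} ℓ (T : Vec Sign (suc n)) →
  InS (suc n) ℓ T ⇔ (agree (head T) (lastSign T) + changes T ≡ ℓ)
InS⇔ ℓ T = mk⇔ to′ from′
  where
  to′ : InS _ ℓ T → agree (head T) (lastSign T) + changes T ≡ ℓ
  to′ (x , isX , nnz≡ℓ) = begin
    agree (head T) (lastSign T) + changes T ≡⟨ sym (nnz-coordinates T) ⟩
    nnz (coordinates T)                     ≡⟨ cong nnz (sym x≡coordinates) ⟩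
    nnz x                                   ≡⟨ nnz≡ℓ ⟩
    ℓ                                       ∎
    where
    open ≡-Reasoning
    x≡coordinates = coordinates-unique T x (IsXTR⇔Solves T x .to isX)
  from′ : agree (head T) (lastSign T) + changes T ≡ ℓ → InS _ ℓ T
  from′ eq = coordinates T
           , IsXTR⇔Solves T (coordinates T) .from (coordinates-solve T)
           , trans (nnz-coordinates T) eq

negative-first : ∀ {n} (T : Vec Sign (suc n)) → NegAt T 1 ⇔ (head T ≡ minus)
negative-first (a ∷ T) = mk⇔ to′ (λ a≡m → F.zero , refl , a≡m)
  where
  to′ : NegAt (a ∷ T) 1 → a ≡ minus
  to′ (F.zero , _ , a≡m) = a≡m

negative-last : ∀ {n} (T : Vec Sign (suc n)) → NegAt T (suc n) ⇔ (lastSign T ≡ minus)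
negative-last T = mk⇔ (to′ T) (from′ T)
  where
  to′ : ∀ {n} (T : Vec Sign (suc n)) → NegAt T (suc n) → lastSign T ≡ minus
  to′ (a ∷ [])      (F.zero , _ , a≡m)   = a≡m
  to′ (a ∷ (b ∷ T)) (F.suc f , eq , f≡m) = to′ (b ∷ T) (f , ℕP.suc-injective eq , f≡m)
  from′ : ∀ {n} (T : Vec Sign (suc n)) → lastSign T ≡ minus → NegAt T (suc n)
  from′ (a ∷ [])      l≡m = F.zero , refl , l≡m
  from′ (a ∷ (b ∷ T)) l≡m with from′ (b ∷ T) l≡m
  ... | f , eq , f≡m = F.suc f , cong suc eq , f≡m

-- The decomposition of the negative part into maximal intervals
--
-- Scanning T from left to right and recording each maximal run of negative entries
-- as an interval produces a list of separated intervals whose union is T^-, with one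
-- interval per negative run.  The scan is stated for T placed at positions k, k+1, …

NegFrom : ∀ {n} → ℕ → Vec Sign n → ℕ → Set
NegFrom k T e = ∃[ f ] (k + toℕ f ≡ e × lookup T f ≡ minus)

negFrom-here : ∀ {n} k (T : Vec Sign n) {e} → k ≡ e → NegFrom k (minus ∷ T) e
negFrom-here k T k≡e = F.zero , trans (ℕP.+-identityʳ k) k≡e , refl

negFrom-there : ∀ {n} k a (T : Vec Sign n) {e} → NegFrom (suc k) T e → NegFrom k (a ∷ T) e
negFrom-there k a T (f , eq , f≡m) = F.suc f , trans (ℕP.+-suc k (toℕ f)) eq , f≡m

negFrom-cons : ∀ {n} k a (T : Vec Sign n) {e} → NegFrom k (a ∷ T) e →
  (a ≡ minus × k ≡ e) ⊎ NegFrom (suc k) T e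
negFrom-cons k a T (F.zero  , eq , a≡m) = inj₁ (a≡m , trans (sym (ℕP.+-identityʳ k)) eq)
negFrom-cons k a T (F.suc f , eq , f≡m) = inj₂ (f , trans (sym (ℕP.+-suc k (toℕ f))) eq , f≡m)

mutual
  intervalsFrom : ∀ {n} → ℕ → Vec Sign n → List (ℕ × ℕ)
  intervalsFrom k []          = []
  intervalsFrom k (plus  ∷ T) = intervalsFrom (suc k) T
  intervalsFrom k (minus ∷ T) = extending k k T

  -- the same while the negative interval [s, p] is still open (T starts at p + 1)
  extending : ∀ {n} → ℕ → ℕ → Vec Sign n → List (ℕ × ℕ)
  extending s p []          = (s , p) ∷ []
  extending s p (minus ∷ T) = extending s (suc p) T
  extending s p (plus  ∷ T) = (s , p) ∷ intervalsFrom (suc (suc p)) T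

intervals : ∀ {n} → Vec Sign n → List (ℕ × ℕ)
intervals = intervalsFrom 1

mutual
  intervalsFrom-sound : ∀ {n} k (T : Vec Sign n) e → InUnion (intervalsFrom k T) e → NegFrom k T e
  intervalsFrom-sound k (plus ∷ T) e e∈ = negFrom-there k plus T (intervalsFrom-sound (suc k) T e e∈)
  intervalsFrom-sound k (minus ∷ T) e e∈ with extending-sound k k T e e∈
  ... | inj₁ (k≤e , e≤k) = negFrom-here k T (ℕP.≤-antisym k≤e e≤k)
  ... | inj₂ neg         = negFrom-there k minus T neg

  extending-sound : ∀ {n} s p (T : Vec Sign n) e → InUnion (extending s p T) e →
    (s ≤ e × e ≤ p) ⊎ NegFrom (suc p) T e
  extending-sound s p [] e (here e∈[s,p]) = inj₁ e∈[s,p]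
  extending-sound s p (minus ∷ T) e e∈ with extending-sound s (suc p) T e e∈
  ... | inj₂ neg = inj₂ (negFrom-there (suc p) minus T neg)
  ... | inj₁ (s≤e , e≤1+p) with ℕP.m≤n⇒m<n∨m≡n e≤1+p
  ...   | inj₁ e<1+p = inj₁ (s≤e , ℕP.≤-pred e<1+p)
  ...   | inj₂ e≡1+p = inj₂ (negFrom-here (suc p) T (sym e≡1+p))
  extending-sound s p (plus ∷ T) e (here e∈[s,p]) = inj₁ e∈[s,p]
  extending-sound s p (plus ∷ T) e (there e∈) =
    inj₂ (negFrom-there (suc p) plus T (intervalsFrom-sound (suc (suc p)) T e e∈))

mutual
  intervalsFrom-complete : ∀ {n} k (T : Vec Sign n) e → NegFrom k T e → InUnion (intervalsFrom k T) e
  intervalsFrom-complete k (a ∷ T) e neg with a | negFrom-cons k a T neg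
  ... | plus  | inj₁ (() , _)
  ... | plus  | inj₂ neg′      = intervalsFrom-complete (suc k) T e neg′
  ... | minus | inj₁ (_ , k≡e) =
    extending-complete k k T e ℕP.≤-refl (inj₁ (ℕP.≤-reflexive k≡e , ℕP.≤-reflexive (sym k≡e)))
  ... | minus | inj₂ neg′      = extending-complete k k T e ℕP.≤-refl (inj₂ neg′)

  extending-complete : ∀ {n} s p (T : Vec Sign n) e → s ≤ p →
    (s ≤ e × e ≤ p) ⊎ NegFrom (suc p) T e → InUnion (extending s p T) e
  extending-complete s p [] e s≤p (inj₁ e∈[s,p]) = here e∈[s,p]
  extending-complete s p (minus ∷ T) e s≤p (inj₁ (s≤e , e≤p)) =
    extending-complete s (suc p) T e (ℕP.m≤n⇒m≤1+n s≤p) (inj₁ (s≤e , ℕP.m≤n⇒m≤1+n e≤p))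
  extending-complete s p (minus ∷ T) e s≤p (inj₂ neg) with negFrom-cons (suc p) minus T neg
  ... | inj₁ (_ , refl) =
    extending-complete s (suc p) T e (ℕP.m≤n⇒m≤1+n s≤p) (inj₁ (ℕP.m≤n⇒m≤1+n s≤p , ℕP.≤-refl))
  ... | inj₂ neg′       = extending-complete s (suc p) T e (ℕP.m≤n⇒m≤1+n s≤p) (inj₂ neg′)
  extending-complete s p (plus ∷ T) e s≤p (inj₁ e∈[s,p]) = here e∈[s,p]
  extending-complete s p (plus ∷ T) e s≤p (inj₂ neg) with negFrom-cons (suc p) plus T neg
  ... | inj₁ (() , _)
  ... | inj₂ neg′ = there (intervalsFrom-complete (suc (suc p)) T e neg′)

SeparatedFrom : ℕ → List (ℕ × ℕ) → Set
SeparatedFrom k []            = ⊤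
SeparatedFrom k ((i , j) ∷ L) = k ≤ i × i ≤ j × SeparatedFrom (suc (suc j)) L

separatedFrom-weaken : ∀ {k k′} L → k′ ≤ k → SeparatedFrom k L → SeparatedFrom k′ L
separatedFrom-weaken []            k′≤k sep                = tt
separatedFrom-weaken ((i , j) ∷ L) k′≤k (k≤i , i≤j , rest) = ℕP.≤-trans k′≤k k≤i , i≤j , rest

separatedFrom⇒separated : ∀ k L → SeparatedFrom k L → Separated L
separatedFrom⇒separated k []                          sep                = tt
separatedFrom⇒separated k ((i , j) ∷ [])              (_ , i≤j , _)      = i≤j
separatedFrom⇒separated k ((i , j) ∷ ((i′ , j′) ∷ L)) (_ , i≤j , rest) =
  i≤j , subst (_≤ i′) (ℕP.+-comm 2 j) (proj₁ rest) , separatedFrom⇒separated _ ((i′ , j′) ∷ L) rest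

mutual
  intervalsFrom-separated : ∀ {n} k (T : Vec Sign n) → SeparatedFrom k (intervalsFrom k T)
  intervalsFrom-separated k []          = tt
  intervalsFrom-separated k (plus  ∷ T) =
    separatedFrom-weaken (intervalsFrom (suc k) T) (ℕP.n≤1+n k) (intervalsFrom-separated (suc k) T)
  intervalsFrom-separated k (minus ∷ T) = extending-separated k k T ℕP.≤-refl

  extending-separated : ∀ {n} s p (T : Vec Sign n) → s ≤ p → SeparatedFrom s (extending s p T)
  extending-separated s p []          s≤p = ℕP.≤-refl , s≤p , tt
  extending-separated s p (minus ∷ T) s≤p = extending-separated s (suc p) T (ℕP.m≤n⇒m≤1+n s≤p)
  extending-separated s p (plus  ∷ T) s≤p = ℕP.≤-refl , s≤p , intervalsFrom-separated (suc (suc p)) T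

-- One interval per negative run; outside (inside) a negative run the scanned T is
-- counted as preceded by a plus (a minus).
mutual
  intervalsFrom-length : ∀ {n} k (T : Vec Sign n) →
    length (intervalsFrom k T) ≡ minusRuns plus (runs (plus ∷ T))
  intervalsFrom-length k []          = refl
  intervalsFrom-length k (plus  ∷ T) = intervalsFrom-length (suc k) T
  intervalsFrom-length k (minus ∷ T) = extending-length k k T

  extending-length : ∀ {n} s p (T : Vec Sign n) →
    length (extending s p T) ≡ minusRuns minus (runs (minus ∷ T))
  extending-length s p []          = refl
  extending-length s p (minus ∷ T) = extending-length s (suc p) T
  extending-length s p (plus  ∷ T) = cong suc (intervalsFrom-length (suc (suc p)) T)

intervals-length : ∀ {n} (T : Vec Sign (suc n)) →
  length (intervals T) ≡ minusRuns (head T) (suc (changes T))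
intervals-length (plus  ∷ T) = intervalsFrom-length 2 T
intervals-length (minus ∷ T) = extending-length 1 1 T

extending-first : ∀ {n} s p (T : Vec Sign n) → FirstLeft (extending s p T) s
extending-first s p []          = refl
extending-first s p (minus ∷ T) = extending-first s (suc p) T
extending-first s p (plus  ∷ T) = refl

intervals-first : ∀ {n} (T : Vec Sign (suc n)) → head T ≡ minus → FirstLeft (intervals T) 1
intervals-first (minus ∷ T) refl = extending-first 1 1 T

lastRight-cons : ∀ x L {b} → LastRight L b → LastRight (x ∷ L) b
lastRight-cons x (p ∷ L) last = last

mutual
  intervalsFrom-last : ∀ {n} k (T : Vec Sign (suc n)) → lastSign T ≡ minus →
    LastRight (intervalsFrom k T) (k + n)
  intervalsFrom-last k (minus ∷ T) l≡m = extending-last k k T l≡m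
  intervalsFrom-last {suc n} k (plus ∷ (b ∷ T)) l≡m =
    subst (LastRight (intervalsFrom (suc k) (b ∷ T))) (sym (ℕP.+-suc k n))
          (intervalsFrom-last (suc k) (b ∷ T) l≡m)

  extending-last : ∀ {n} s p (T : Vec Sign n) → lastFrom minus T ≡ minus →
    LastRight (extending s p T) (p + n)
  extending-last s p [] l≡m = sym (ℕP.+-identityʳ p)
  extending-last {suc n} s p (minus ∷ T) l≡m =
    subst (LastRight (extending s (suc p) T)) (sym (ℕP.+-suc p n)) (extending-last s (suc p) T l≡m)
  extending-last {suc (suc n)} s p (plus ∷ (b ∷ T)) l≡m =
    lastRight-cons (s , p) (intervalsFrom (suc (suc p)) (b ∷ T))
      (subst (LastRight (intervalsFrom (suc (suc p)) (b ∷ T)))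
        (sym (trans (ℕP.+-suc p (suc n)) (cong suc (ℕP.+-suc p n))))
        (intervalsFrom-last (suc (suc p)) (b ∷ T) l≡m))

intervals-last : ∀ {n} (T : Vec Sign (suc n)) → lastSign T ≡ minus → LastRight (intervals T) (suc n)
intervals-last = intervalsFrom-last 1

intervals-decompose : ∀ {n} (T : Vec Sign (suc n)) →
  SepDecomp T (minusRuns (head T) (suc (changes T))) (intervals T)
intervals-decompose T =
  intervals-length T ,
  separatedFrom⇒separated 1 (intervals T) (intervalsFrom-separated 1 T) ,
  (λ e → mk⇔ (intervalsFrom-complete 1 T e) (intervalsFrom-sound 1 T e))

-- Enumerating sign sequences by their runs

-- c(m; n) : the number of compositions of n into m positive parts
compositions : ℕ → ℕ → ℕ
compositions zero    zero    = 1
compositions zero    (suc n) = 0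
compositions (suc m) zero    = 0
compositions (suc m) (suc n) = n C m

-- Pascal's rule: the first part of a composition is 1 or it is larger.
compositions-pascal : ∀ m n → compositions (suc m) (suc n) ≡ compositions (suc m) n + compositions m n
compositions-pascal zero    zero    = refl
compositions-pascal (suc m) zero    = refl
compositions-pascal zero    (suc n) = refl
compositions-pascal (suc m) (suc n) =
  trans (sym (nCk+nC[k+1]≡[n+1]C[k+1] n m)) (ℕP.+-comm (n C m) (n C suc m))

StartsWith : ∀ {n} → Sign → Vec Sign n → Set
StartsWith a []      = ⊤
StartsWith a (b ∷ T) = b ≡ a

alternating : (n : ℕ) → Sign → ℕ → List (Vec Sign n)
alternating zero    a zero    = [] ∷ []
alternating zero    a (suc k) = []
alternating (suc n) a zero    = []
alternating (suc n) a (suc k) = map (a ∷_) (alternating n a (suc k) ++ alternating n (flip a) k)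

runs-stay : ∀ {n} a (T : Vec Sign n) {k} → StartsWith a T → runs T ≡ suc k → runs (a ∷ T) ≡ suc k
runs-stay plus  (plus  ∷ T) refl eq = eq
runs-stay minus (minus ∷ T) refl eq = eq

runs-switch : ∀ {n} a (T : Vec Sign n) → StartsWith (flip a) T → runs (a ∷ T) ≡ suc (runs T)
runs-switch a     []          _    = refl
runs-switch plus  (minus ∷ T) refl = refl
runs-switch minus (plus  ∷ T) refl = refl

∈-map-cons⁻ : ∀ {n} {a b} {T : Vec Sign n} {L} → b ∷ T ∈ map (a ∷_) L → b ≡ a × T ∈ L
∈-map-cons⁻ b∷T∈ with ∈-map⁻ (_ ∷_) b∷T∈
... | T′ , T′∈L , refl = refl , T′∈L

alternating-sound : ∀ n a k (T : Vec Sign n) → T ∈ alternating n a k → StartsWith a T × runs T ≡ k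
alternating-sound zero    a zero    []      _    = _ , refl
alternating-sound (suc n) a (suc k) (b ∷ T) b∷T∈ with ∈-map-cons⁻ b∷T∈
... | refl , T∈ = refl , [ stay , switch ]′ (∈-++⁻ (alternating n a (suc k)) T∈)
  where
  stay : T ∈ alternating n a (suc k) → runs (a ∷ T) ≡ suc k
  stay T∈ with alternating-sound n a (suc k) T T∈
  ... | starts , runs≡ = runs-stay a T starts runs≡
  switch : T ∈ alternating n (flip a) k → runs (a ∷ T) ≡ suc k
  switch T∈ with alternating-sound n (flip a) k T T∈
  ... | starts , refl = runs-switch a T starts

alternating-complete : ∀ {n} a (T : Vec Sign n) → StartsWith a T → T ∈ alternating n a (runs T)
alternating-complete a     []                _    = here refl
alternating-complete a     (a′ ∷ [])         refl = ∈-map⁺ (a′ ∷_) (∈-++⁺ʳ [] (here refl))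
alternating-complete plus  (plus  ∷ (plus  ∷ T)) refl =
  ∈-map⁺ (plus ∷_) (∈-++⁺ˡ (alternating-complete plus (plus ∷ T) refl))
alternating-complete plus  (plus  ∷ (minus ∷ T)) refl =
  ∈-map⁺ (plus ∷_) (∈-++⁺ʳ (alternating _ plus _) (alternating-complete minus (minus ∷ T) refl))
alternating-complete minus (minus ∷ (minus ∷ T)) refl =
  ∈-map⁺ (minus ∷_) (∈-++⁺ˡ (alternating-complete minus (minus ∷ T) refl))
alternating-complete minus (minus ∷ (plus  ∷ T)) refl =
  ∈-map⁺ (minus ∷_) (∈-++⁺ʳ (alternating _ minus _) (alternating-complete plus (plus ∷ T) refl))

alternating-unique : ∀ n a k → Unique (alternating n a k)
alternating-unique zero    a zero    = All.[] ∷ []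
alternating-unique zero    a (suc k) = []
alternating-unique (suc n) a zero    = []
alternating-unique (suc n) a (suc k) =
  UniqueP.map⁺ VecP.∷-injectiveʳ
    (UniqueP.++⁺ (alternating-unique n a (suc k)) (alternating-unique n (flip a) k) disjoint)
  where
  -- a sequence of suc k runs is nonempty, so it cannot start with both a and flip a
  disjoint : ∀ {T} → T ∈ alternating n a (suc k) × T ∈ alternating n (flip a) k → ⊥
  disjoint {T} (T∈stay , T∈switch)
    with alternating-sound n a (suc k) T T∈stay | alternating-sound n (flip a) k T T∈switch
  disjoint {b ∷ T} _ | b≡a , _ | b≡flip-a , _ = flip-≢ _ (trans (sym b≡a) b≡flip-a)

alternating-length : ∀ n a k → length (alternating n a k) ≡ compositions k n
alternating-length zero    a zero    = refl
alternating-length zero    a (suc k) = refl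
alternating-length (suc n) a zero    = refl
alternating-length (suc n) a (suc k) = begin
  length (map (a ∷_) (stay ++ switch))
    ≡⟨ ListP.length-map (a ∷_) (stay ++ switch) ⟩
  length (stay ++ switch)
    ≡⟨ ListP.length-++ stay ⟩
  length stay + length switch
    ≡⟨ cong₂ _+_ (alternating-length n a (suc k)) (alternating-length n (flip a) k) ⟩
  compositions (suc k) n + compositions k n
    ≡⟨ sym (compositions-pascal k n) ⟩
  compositions (suc k) (suc n) ∎
  where
  open ≡-Reasoning
  stay   = alternating n a (suc k)
  switch = alternating n (flip a) k

withNegatives : ∀ {n} → ℕ → List (Vec Sign n) → List (Vec Sign n)
withNegatives j = filter (λ T → negCount T ≟ j)

filter-map : ∀ {A B : Set} {P : B → Set} (P? : Decidable P) (f : A → B) xs →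
  filter P? (map f xs) ≡ map f (filter (λ x → P? (f x)) xs)
filter-map P? f []       = refl
filter-map P? f (x ∷ xs) with does (P? (f x))
... | true  = cong (f x ∷_) (filter-map P? f xs)
... | false = filter-map P? f xs

withNegatives-++ : ∀ {n} j (L L′ : List (Vec Sign n)) →
  length (withNegatives j (L ++ L′)) ≡ length (withNegatives j L) + length (withNegatives j L′)
withNegatives-++ j L L′ = trans (cong length (ListP.filter-++ (λ T → negCount T ≟ j) L L′))
                                (ListP.length-++ (withNegatives j L))

withNegatives-plus : ∀ {n} j (L : List (Vec Sign n)) →
  length (withNegatives j (map (plus ∷_) L)) ≡ length (withNegatives j L)
withNegatives-plus j L = trans (cong length (filter-map (λ T → negCount T ≟ j) (plus ∷_) L))
                               (ListP.length-map (plus ∷_) (withNegatives j L))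

withNegatives-minus : ∀ {n} j (L : List (Vec Sign n)) →
  length (withNegatives (suc j) (map (minus ∷_) L)) ≡ length (withNegatives j L)
withNegatives-minus j L = begin
  length (withNegatives (suc j) (map (minus ∷_) L))
    ≡⟨ cong length (filter-map (λ T → negCount T ≟ suc j) (minus ∷_) L) ⟩
  length (map (minus ∷_) (filter (λ T → suc (negCount T) ≟ suc j) L))
    ≡⟨ ListP.length-map (minus ∷_) (filter (λ T → suc (negCount T) ≟ suc j) L) ⟩
  length (filter (λ T → suc (negCount T) ≟ suc j) L)
    ≡⟨ cong length (ListP.filter-≐ (λ T → suc (negCount T) ≟ suc j) (λ T → negCount T ≟ j)
                      (ℕP.suc-injective , cong suc) L) ⟩
  length (withNegatives j L) ∎
  where open ≡-Reasoning

withNegatives-minus-zero : ∀ {n} (L : List (Vec Sign n)) →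
  length (withNegatives 0 (map (minus ∷_) L)) ≡ 0
withNegatives-minus-zero L = cong length (trans (filter-map (λ T → negCount T ≟ 0) (minus ∷_) L)
  (cong (map (minus ∷_)) (ListP.filter-none (λ T → suc (negCount T) ≟ 0) (All.universal (λ _ ()) L))))

negCount≤length : ∀ {n} (T : Vec Sign n) → negCount T ≤ n
negCount≤length []          = z≤n
negCount≤length (plus  ∷ T) = ℕP.m≤n⇒m≤1+n (negCount≤length T)
negCount≤length (minus ∷ T) = s≤s (negCount≤length T)

withNegatives-none : ∀ {n j} → n < j → (L : List (Vec Sign n)) → length (withNegatives j L) ≡ 0
withNegatives-none {n} n<j L = cong length (ListP.filter-none (λ T → negCount T ≟ _)
  (All.universal (λ T negCount≡j → ℕP.<⇒≱ n<j (subst (_≤ n) negCount≡j (negCount≤length T))) L))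

alternating-negatives : ∀ n a k j q → j + q ≡ n →
  length (withNegatives j (alternating n a k)) ≡
    compositions (minusRuns a k) j * compositions (plusRuns a k) q
alternating-negatives zero    a     zero    zero    zero    refl = refl
alternating-negatives zero    minus (suc k) zero    zero    refl = refl
alternating-negatives zero    plus  (suc k) zero    zero    refl =
  sym (ℕP.*-zeroʳ (compositions (minusRuns minus k) 0))
alternating-negatives (suc n) a     zero    (suc j) q       eq   = refl
alternating-negatives (suc n) a     zero    zero    (suc q) eq   = refl
alternating-negatives (suc n) minus (suc k) zero    q       eq   =
  withNegatives-minus-zero (alternating n minus (suc k) ++ alternating n plus k)
alternating-negatives (suc n) minus (suc k) (suc j) q       eq   = begin
  length (withNegatives (suc j) (map (minus ∷_) (stay ++ switch)))
    ≡⟨ withNegatives-minus j (stay ++ switch) ⟩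
  length (withNegatives j (stay ++ switch))
    ≡⟨ withNegatives-++ j stay switch ⟩
  length (withNegatives j stay) + length (withNegatives j switch)
    ≡⟨ cong₂ _+_ (alternating-negatives n minus (suc k) j q j+q≡n)
                 (alternating-negatives n plus k j q j+q≡n) ⟩
  compositions (suc m) j * compositions p q + compositions m j * compositions p q
    ≡⟨ sym (ℕP.*-distribʳ-+ (compositions p q) (compositions (suc m) j) (compositions m j)) ⟩
  (compositions (suc m) j + compositions m j) * compositions p q
    ≡⟨ cong (_* compositions p q) (sym (compositions-pascal m j)) ⟩
  compositions (suc m) (suc j) * compositions p q ∎
  where
  open ≡-Reasoning
  stay   = alternating n minus (suc k)
  switch = alternating n plus k
  m      = minusRuns plus k
  p      = minusRuns minus k
  j+q≡n  = ℕP.suc-injective eq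
alternating-negatives (suc n) plus  (suc k) j       zero    eq   = begin
  length (withNegatives j (map (plus ∷_) (stay ++ switch)))
    ≡⟨ withNegatives-plus j (stay ++ switch) ⟩
  length (withNegatives j (stay ++ switch))
    ≡⟨ withNegatives-++ j stay switch ⟩
  length (withNegatives j stay) + length (withNegatives j switch)
    ≡⟨ cong₂ _+_ (withNegatives-none n<j stay) (withNegatives-none n<j switch) ⟩
  0
    ≡⟨ sym (ℕP.*-zeroʳ (compositions (minusRuns minus k) j)) ⟩
  compositions (minusRuns minus k) j * 0 ∎
  where
  open ≡-Reasoning
  stay   = alternating n plus (suc k)
  switch = alternating n minus k
  n<j : n < j
  n<j = ℕP.≤-reflexive (sym (trans (sym (ℕP.+-identityʳ j)) eq))
alternating-negatives (suc n) plus  (suc k) j       (suc q) eq   = begin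
  length (withNegatives j (map (plus ∷_) (stay ++ switch)))
    ≡⟨ withNegatives-plus j (stay ++ switch) ⟩
  length (withNegatives j (stay ++ switch))
    ≡⟨ withNegatives-++ j stay switch ⟩
  length (withNegatives j stay) + length (withNegatives j switch)
    ≡⟨ cong₂ _+_ (alternating-negatives n plus (suc k) j q j+q≡n)
                 (alternating-negatives n minus k j q j+q≡n) ⟩
  compositions m j * compositions (suc p) q + compositions m j * compositions p q
    ≡⟨ sym (ℕP.*-distribˡ-+ (compositions m j) (compositions (suc p) q) (compositions p q)) ⟩
  compositions m j * (compositions (suc p) q + compositions p q)
    ≡⟨ cong (compositions m j *_) (sym (compositions-pascal p q)) ⟩
  compositions m j * compositions (suc p) (suc q) ∎
  where
  open ≡-Reasoning
  stay   = alternating n plus (suc k)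
  switch = alternating n minus k
  m      = minusRuns minus k
  p      = minusRuns plus k
  j+q≡n  = ℕP.suc-injective (trans (sym (ℕP.+-suc j q)) eq)

-- Counting topes by shape: the topes of length n+1 with c sign changes are the
-- sequences with c+1 runs.

HasShape : ∀ {n} → Sign → ℕ → Vec Sign (suc n) → Set
HasShape a c T = head T ≡ a × changes T ≡ c

alternating-topes : ∀ {n} a c (T : Vec Sign (suc n)) →
  T ∈ alternating (suc n) a (suc c) ⇔ HasShape a c T
alternating-topes a c (b ∷ T) = mk⇔ to′ from′
  where
  to′ : b ∷ T ∈ alternating _ a (suc c) → HasShape a c (b ∷ T)
  to′ b∷T∈ with alternating-sound _ a (suc c) (b ∷ T) b∷T∈
  ... | b≡a , runs≡ = b≡a , ℕP.suc-injective runs≡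
  from′ : HasShape a c (b ∷ T) → b ∷ T ∈ alternating _ a (suc c)
  from′ (refl , refl) = alternating-complete b (b ∷ T) refl

shape-counts : ∀ n ℓ a c (F : Vec Sign (suc n) → Set) →
  (∀ T → (InS (suc n) ℓ T × F T) ⇔ HasShape a c T) →
  CountIs (suc n) (λ T → InS (suc n) ℓ T × F T) (n C c)
  × (∀ j → j ≤ suc n →
       CountIs (suc n) (λ T → InS (suc n) ℓ T × negCount T ≡ j × F T)
         (compositions (minusRuns a (suc c)) j * compositions (plusRuns a (suc c)) (suc n ∸ j)))
shape-counts n ℓ a c F shape =
  ( topes , alternating-unique _ a (suc c)
  , (λ T → mk⇔ (λ T∈ → shape T .from (alternating-topes a c T .to T∈))
               (λ inF → alternating-topes a c T .from (shape T .to inF)))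
  , alternating-length (suc n) a (suc c) )
  , λ j j≤t →
      ( withNegatives j topes , UniqueP.filter⁺ (λ T → negCount T ≟ j) (alternating-unique _ a (suc c))
      , (λ T → mk⇔ (λ T∈ → with-j T (∈-filter⁻ (λ T → negCount T ≟ j) T∈))
                   (λ (inS , negs , inF) → ∈-filter⁺ (λ T → negCount T ≟ j)
                      (alternating-topes a c T .from (shape T .to (inS , inF))) negs))
      , alternating-negatives (suc n) a (suc c) j (suc n ∸ j) (ℕP.m+[n∸m]≡n j≤t) )
  where
  topes = alternating (suc n) a (suc c)
  with-j : ∀ {j} T → T ∈ topes × negCount T ≡ j → InS (suc n) ℓ T × negCount T ≡ j × F T
  with-j T (T∈ , negs) with shape T .from (alternating-topes a c T .to T∈)
  ... | inS , inF = inS , negs , inF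

-- For T ∈ S_ℓ the family fixes the end signs
-- and hence, by InS⇔, the number of sign changes; conversely a shape fixes the last sign
-- by parity, and the canonical decomposition of T^- witnesses the family.

inS-ends⇒ : ∀ {n ℓ a b} (T : Vec Sign (suc n)) → head T ≡ a → lastSign T ≡ b →
  InS (suc n) ℓ T → agree a b + changes T ≡ ℓ
inS-ends⇒ {ℓ = ℓ} T refl refl = InS⇔ ℓ T .to

ends⇒inS : ∀ {n ℓ a b} (T : Vec Sign (suc n)) → head T ≡ a → lastSign T ≡ b →
  agree a b + changes T ≡ ℓ → InS (suc n) ℓ T
ends⇒inS {ℓ = ℓ} T refl refl = InS⇔ ℓ T .from

shape-last : ∀ {n a c} (T : Vec Sign (suc n)) → HasShape a c T → lastSign T ≡ alternate c a
shape-last (b ∷ T) (refl , refl) = lastFrom-parity b T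

shape-decompose : ∀ {n a c m} (T : Vec Sign (suc n)) → HasShape a c T →
  minusRuns a (suc c) ≡ m → SepDecomp T m (intervals T)
shape-decompose T (refl , refl) refl = intervals-decompose T

famA-shape : ∀ n r (T : Vec Sign (suc n)) →
  (InS (suc n) (suc (2 * r)) T × FamA (suc n) (suc r) T) ⇔ HasShape minus (suc (2 * r)) T
famA-shape n r T = mk⇔ to′ from′
  where
  to′ : InS _ _ T × FamA _ _ T → HasShape minus (suc (2 * r)) T
  to′ (inS , _ , _ , _ , neg₁ , ¬negₜ) = first , inS-ends⇒ T first last inS
    where
    first = negative-first T .to neg₁
    last  = not-minus (λ l → ¬negₜ (negative-last T .from l))
  from′ : HasShape minus (suc (2 * r)) T → InS _ _ T × FamA _ _ T
  from′ shape@(first , c) =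
    ends⇒inS T first last c , intervals T ,
    shape-decompose T shape (cong suc (minusRuns-even minus r)) , intervals-first T first ,
    negative-first T .from first , (λ negₜ → plus≢minus (trans (sym last) (negative-last T .to negₜ)))
    where
    last = trans (shape-last T shape) (alternate-odd r minus)

famB-shape : ∀ n r (T : Vec Sign (suc n)) →
  (InS (suc n) (suc (2 * r)) T × FamB (suc n) (suc r) T) ⇔ HasShape plus (suc (2 * r)) T
famB-shape n r T = mk⇔ to′ from′
  where
  to′ : InS _ _ T × FamB _ _ T → HasShape plus (suc (2 * r)) T
  to′ (inS , _ , _ , _ , negₜ , ¬neg₁) = first , inS-ends⇒ T first last inS
    where
    first = not-minus (λ f → ¬neg₁ (negative-first T .from f))
    last  = negative-last T .to negₜ
  from′ : HasShape plus (suc (2 * r)) T → InS _ _ T × FamB _ _ T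
  from′ shape@(first , c) =
    ends⇒inS T first last c , intervals T ,
    shape-decompose T shape (cong suc (minusRuns-even plus r)) , intervals-last T last ,
    negative-last T .from last , (λ neg₁ → plus≢minus (trans (sym first) (negative-first T .to neg₁)))
    where
    last = trans (shape-last T shape) (alternate-odd r plus)

famC-shape : ∀ n r (T : Vec Sign (suc n)) →
  (InS (suc n) (suc (2 * r)) T × FamC (suc n) (suc r) T) ⇔ HasShape minus (2 * r) T
famC-shape n r T = mk⇔ to′ from′
  where
  to′ : InS _ _ T × FamC _ _ T → HasShape minus (2 * r) T
  to′ (inS , _ , _ , _ , _ , neg₁ , negₜ) = first , ℕP.suc-injective (inS-ends⇒ T first last inS)
    where
    first = negative-first T .to neg₁
    last  = negative-last T .to negₜ
  from′ : HasShape minus (2 * r) T → InS _ _ T × FamC _ _ T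
  from′ shape@(first , c) =
    ends⇒inS T first last (cong suc c) , intervals T ,
    shape-decompose T shape (cong suc (minusRuns-even plus r)) ,
    intervals-first T first , intervals-last T last ,
    negative-first T .from first , negative-last T .from last
    where
    last = trans (shape-last T shape) (alternate-even r minus)

famD-shape : ∀ n r (T : Vec Sign (suc n)) →
  (InS (suc n) (suc (2 * r)) T × FamD (suc n) r T) ⇔ HasShape plus (2 * r) T
famD-shape n r T = mk⇔ to′ from′
  where
  to′ : InS _ _ T × FamD _ _ T → HasShape plus (2 * r) T
  to′ (inS , _ , _ , ¬neg₁ , ¬negₜ) = first , ℕP.suc-injective (inS-ends⇒ T first last inS)
    where
    first = not-minus (λ f → ¬neg₁ (negative-first T .from f))
    last  = not-minus (λ l → ¬negₜ (negative-last T .from l))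
  from′ : HasShape plus (2 * r) T → InS _ _ T × FamD _ _ T
  from′ shape@(first , c) =
    ends⇒inS T first last (cong suc c) , intervals T ,
    shape-decompose T shape (minusRuns-even minus r) ,
    (λ neg₁ → plus≢minus (trans (sym first) (negative-first T .to neg₁))) ,
    (λ negₜ → plus≢minus (trans (sym last) (negative-last T .to negₜ)))
    where
    last = trans (shape-last T shape) (alternate-even r plus)

-- The counts of the theorem: the composition numbers given by shape-counts, rewritten
-- as the binomial coefficients of the statement (t = n + 1, ℓ = 2r + 1).

compositions-binomial : ∀ {parts} k m → parts ≡ suc k → 1 ≤ m → compositions parts m ≡ (m ∸ 1) C k
compositions-binomial k (suc m) refl _ = refl

recount : ∀ {t P a b} → a ≡ b → CountIs t P a → CountIs t P b
recount refl count = count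

-- j ≤ t - k - 1 forces a positive entry besides the j negative ones
positive-rest : ∀ {n j} k → j ≤ n ∸ k → 1 ≤ suc n ∸ j
positive-rest {n} k j≤ = ℕP.m<n⇒0<n∸m (s≤s (ℕP.≤-trans j≤ (ℕP.m∸n≤m n k)))

1≤ : ∀ {r j} → suc r ≤ j → 1 ≤ j
1≤ = ℕP.≤-trans (s≤s z≤n)

famA-counts : ∀ n r →
  CountIs (suc n) (λ T → InS (suc n) (suc (2 * r)) T × FamA (suc n) (suc r) T) (n C suc (2 * r))
  × (∀ j → suc r ≤ j → j ≤ suc n ∸ suc r →
       CountIs (suc n) (λ T → InS (suc n) (suc (2 * r)) T × negCount T ≡ j × FamA (suc n) (suc r) T)
         (((j ∸ 1) C r) * ((suc n ∸ j ∸ 1) C r)))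
famA-counts n r = proj₁ counts , λ j lo hi →
  recount (cong₂ _*_ (compositions-binomial r j (cong suc (minusRuns-even minus r)) (1≤ lo))
                     (compositions-binomial r (suc n ∸ j) (cong suc (minusRuns-even plus r))
                                            (positive-rest r hi)))
          (proj₂ counts j (ℕP.≤-trans hi (ℕP.m∸n≤m (suc n) (suc r))))
  where
  counts = shape-counts n (suc (2 * r)) minus (suc (2 * r)) (FamA (suc n) (suc r)) (famA-shape n r)

famB-counts : ∀ n r →
  CountIs (suc n) (λ T → InS (suc n) (suc (2 * r)) T × FamB (suc n) (suc r) T) (n C suc (2 * r))
  × (∀ j → suc r ≤ j → j ≤ suc n ∸ suc r →
       CountIs (suc n) (λ T → InS (suc n) (suc (2 * r)) T × negCount T ≡ j × FamB (suc n) (suc r) T)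
         (((j ∸ 1) C r) * ((suc n ∸ j ∸ 1) C r)))
famB-counts n r = proj₁ counts , λ j lo hi →
  recount (cong₂ _*_ (compositions-binomial r j (cong suc (minusRuns-even plus r)) (1≤ lo))
                     (compositions-binomial r (suc n ∸ j) (cong suc (minusRuns-even minus r))
                                            (positive-rest r hi)))
          (proj₂ counts j (ℕP.≤-trans hi (ℕP.m∸n≤m (suc n) (suc r))))
  where
  counts = shape-counts n (suc (2 * r)) plus (suc (2 * r)) (FamB (suc n) (suc r)) (famB-shape n r)

famC-counts : ∀ n r → 1 ≤ r →
  CountIs (suc n) (λ T → InS (suc n) (suc (2 * r)) T × FamC (suc n) (suc r) T) (n C (2 * r))
  × (∀ j → suc r ≤ j → j ≤ suc n ∸ r →
       CountIs (suc n) (λ T → InS (suc n) (suc (2 * r)) T × negCount T ≡ j × FamC (suc n) (suc r) T)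
         (((j ∸ 1) C r) * ((suc n ∸ j ∸ 1) C (r ∸ 1))))
famC-counts n r@(suc r′) _ = proj₁ counts , λ j lo hi →
  recount (cong₂ _*_ (compositions-binomial r j (cong suc (minusRuns-even plus r)) (1≤ lo))
                     (compositions-binomial r′ (suc n ∸ j) (minusRuns-even minus r) (positive-rest r′ hi)))
          (proj₂ counts j (ℕP.≤-trans hi (ℕP.m∸n≤m (suc n) r)))
  where
  counts = shape-counts n (suc (2 * r)) minus (2 * r) (FamC (suc n) (suc r)) (famC-shape n r)

famD-counts : ∀ n r → 1 ≤ r →
  CountIs (suc n) (λ T → InS (suc n) (suc (2 * r)) T × FamD (suc n) r T) (n C (2 * r))
  × (∀ j → r ≤ j → j ≤ suc n ∸ suc r →
       CountIs (suc n) (λ T → InS (suc n) (suc (2 * r)) T × negCount T ≡ j × FamD (suc n) r T)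
         (((j ∸ 1) C (r ∸ 1)) * ((suc n ∸ j ∸ 1) C r)))
famD-counts n r@(suc r′) _ = proj₁ counts , λ j lo hi →
  recount (cong₂ _*_ (compositions-binomial r′ j (minusRuns-even minus r) (1≤ lo))
                     (compositions-binomial r (suc n ∸ j) (cong suc (minusRuns-even plus r))
                                            (positive-rest r hi)))
          (proj₂ counts j (ℕP.≤-trans hi (ℕP.m∸n≤m (suc n) (suc r))))
  where
  counts = shape-counts n (suc (2 * r)) plus (2 * r) (FamD (suc n) r) (famD-shape n r)

mainTheorem2 : (t ℓ r : ℕ) → 3 ≤ t → ℓ ≡ suc (2 * r) → 3 ≤ ℓ → ℓ ≤ t →
    -- (i)(a)
    (CountIs t (λ T → InS t ℓ T × FamA t (suc r) T) ((t ∸ 1) C ℓ)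
     × (∀ j → suc r ≤ j → j ≤ t ∸ suc r →
          CountIs t (λ T → InS t ℓ T × negCount T ≡ j × FamA t (suc r) T)
            (((j ∸ 1) C r) * ((t ∸ j ∸ 1) C r))))
    -- (i)(b)
    × (CountIs t (λ T → InS t ℓ T × FamB t (suc r) T) ((t ∸ 1) C ℓ)
     × (∀ j → suc r ≤ j → j ≤ t ∸ suc r →
          CountIs t (λ T → InS t ℓ T × negCount T ≡ j × FamB t (suc r) T)
            (((j ∸ 1) C r) * ((t ∸ j ∸ 1) C r))))
    -- (ii)
    × (CountIs t (λ T → InS t ℓ T × FamC t (suc r) T) ((t ∸ 1) C (ℓ ∸ 1))
     × (∀ j → suc r ≤ j → j ≤ t ∸ r →
          CountIs t (λ T → InS t ℓ T × negCount T ≡ j × FamC t (suc r) T)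
            (((j ∸ 1) C r) * ((t ∸ j ∸ 1) C (r ∸ 1)))))
    -- (iii)
    × (CountIs t (λ T → InS t ℓ T × FamD t r T) ((t ∸ 1) C (ℓ ∸ 1))
     × (∀ j → r ≤ j → j ≤ t ∸ suc r →
          CountIs t (λ T → InS t ℓ T × negCount T ≡ j × FamD t r T)
            (((j ∸ 1) C (r ∸ 1)) * ((t ∸ j ∸ 1) C r))))
mainTheorem2 (suc n) _ zero        _ refl (s≤s ()) _
mainTheorem2 (suc n) _ r@(suc _) _ refl _        _ =
  famA-counts n r , famB-counts n r , famC-counts n r 1≤r , famD-counts n r 1≤r
  where
  1≤r : 1 ≤ r
  1≤r = s≤s z≤n
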